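{- Let $G$ be a graph, $t\ge3$, let $S_1,S_2$ be two disjoint subsets of $V(G)$ such that $S_1$ contains no $t$-clique, and let $\beta$ be an integer such that $\mathsf{mmbs}_t(G[S_2]) \le \beta$. Then $\mathsf{conf}^t_{S_1}(S_2)=0$ if and only if for every subset $\overline{S}_1 \subseteq S_1$ with $|\overline{S}_1| \le (t-1)\beta$, $\mathsf{conf}^t_{\overline{S}_1}(S_2)=0$.
   Context: A $t$-clique is a set of $t$ pairwise adjacent vertices. $\mathrm{opt}(G)$ is the minimum size of a set intersecting all $t$-cliques of $G$. For a set $\mathcal F$ of subsets $Z\subseteq V(G)$ with $1\le|Z|\le t-1$ and $G[Z]$ a clique, $\mathrm{opt}(G,\mathcal F)$ is the minimum size of a set intersecting all $t$-cliques of $G$ and all $Z\in\mathcal F$; $(G,\mathcal F)$ is clean if $\mathrm{opt}(G,\mathcal F)=\mathrm{opt}(G)$. For disjoint $A,B\subseteq V(G)$, $\mathsf{pr}^t_A(B)=\{K\cap B : K$ a $t$-clique of $G[A\cup B]$ with $K\cap A\neq\emptyset$ and $K\cap B\neq\emptyset\}$. For disjoint $S_1,S_2$ with $S_1$ containing no $t$-clique, $\mathsf{conf}^t_{S_1}(S_2)=\mathrm{opt}(G[S_2],\mathsf{pr}^t_{S_1}(S_2))-\mathrm{opt}(G[S_2])$. A blocking set of $(G,\mathcal F)$ is a set $\mathcal B$ of subsets $B\subseteq V(G)$ with $1\le|B|\le t-1$, $G[B]$ a clique, and $\mathrm{opt}(G,\mathcal F\cup\mathcal B)>\mathrm{opt}(G,\mathcal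 F)$; $\mathsf{mmbs}_t(G,\mathcal F)$ is the maximum size of an inclusion-wise minimal blocking set, and $\mathsf{mmbs}_t(G)$ is the maximum of $\mathsf{mmbs}_t(G,\mathcal F)$ over all clean $(G,\mathcal F)$. -}

module Defs where

open import Data.Nat using (ℕ; _≤_; _<_; _∸_; _*_)
open import Data.Integer using (ℤ; +_; _-_)
open import Data.Fin using (Fin)
open import Data.Fin.Subset using (Subset; _∈_; _⊆_; _∩_; _∪_; ∣_∣; Nonempty; Empty)
open import Data.List using (List; length)
open import Data.List.Relation.Unary.Unique.Propositional using (Unique)
open import Data.List.Membership.Propositional using () renaming (_∈_ to _∈ᴸ_)
open import Data.Product using (Σ; ∃; ∃-syntax; _×_)
open import Data.Sum using (_⊎_)
open import Data.Empty using (⊥)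
open import Relation.Nullary using (¬_)
open import Relation.Binary using (Decidable)
open import Relation.Binary.PropositionalEquality using (_≡_; _≢_)

record Graph : Set₁ where
  field
    n      : ℕ
    Adj    : Fin n → Fin n → Set
    adj?   : Decidable Adj
    sym    : ∀ {u v} → Adj u v → Adj v u
    irrefl : ∀ {u} → ¬ Adj u u

open Graph public

Family : Graph → Set₁
Family G = Subset (n G) → Set

∅F : (G : Graph) → Family G
∅F G _ = ⊥

_∪F_ : {G : Graph} → Family G → Family G → Family G
(F ∪F F') Z = F Z ⊎ F' Z

listF : {G : Graph} → List (Subset (n G)) → Family G
listF B Z = Z ∈ᴸ B

IsClique : (G : Graph) → Subset (n G) → Set
IsClique G K = ∀ {u v} → u ∈ K → v ∈ K → u ≢ v → Adj G u v

IsTClique : (G : Graph) (t : ℕ) (S K : Subset (n G)) → Set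
IsTClique G t S K = K ⊆ S × ∣ K ∣ ≡ t × IsClique G K

NoTClique : (G : Graph) (t : ℕ) (S : Subset (n G)) → Set
NoTClique G t S = ∀ K → ¬ IsTClique G t S K

Hits : (G : Graph) (t : ℕ) (S : Subset (n G)) (F : Family G) (X : Subset (n G)) → Set
Hits G t S F X =
  X ⊆ S × (∀ K → IsTClique G t S K → Nonempty (K ∩ X)) × (∀ Z → F Z → Nonempty (Z ∩ X))

IsOpt : (G : Graph) (t : ℕ) (S : Subset (n G)) (F : Family G) (k : ℕ) → Set
IsOpt G t S F k =
  (∃[ X ] (Hits G t S F X × ∣ X ∣ ≡ k)) × (∀ X → Hits G t S F X → k ≤ ∣ X ∣)

Admissible : (G : Graph) (t : ℕ) (S Z : Subset (n G)) → Set
Admissible G t S Z = Z ⊆ S × 1 ≤ ∣ Z ∣ × ∣ Z ∣ ≤ t ∸ 1 × IsClique G Z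

Clean : (G : Graph) (t : ℕ) (S : Subset (n G)) (F : Family G) → Set
Clean G t S F = ∃[ k ] (IsOpt G t S F k × IsOpt G t S (∅F G) k)

Blocking : (G : Graph) (t : ℕ) (S : Subset (n G)) (F : Family G)
           (B : List (Subset (n G))) → Set
Blocking G t S F B =
  (∀ Z → Z ∈ᴸ B → Admissible G t S Z) ×
  ∃[ k ] ∃[ k' ] (IsOpt G t S (_∪F_ {G} F (listF {G} B)) k' × IsOpt G t S F k × k < k')

MinimalBlocking : (G : Graph) (t : ℕ) (S : Subset (n G)) (F : Family G)
                  (B : List (Subset (n G))) → Set
MinimalBlocking G t S F B =
  Blocking G t S F B ×
  (∀ B' → (∀ Z → Z ∈ᴸ B' → Z ∈ᴸ B) → (∃[ Z ] (Z ∈ᴸ B × ¬ (Z ∈ᴸ B'))) →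
     ¬ Blocking G t S F B')

-- mmbs_t(G[S]) ≤ β : for every clean (G[S], F) (F a family of admissible sets),
-- every inclusion-wise minimal blocking set has at most β members
-- (a set of subsets is represented by a duplicate-free list).
MmbsAtMost : (G : Graph) (t : ℕ) (S : Subset (n G)) (β : ℕ) → Set₁
MmbsAtMost G t S β =
  ∀ (F : Family G) → (∀ Z → F Z → Admissible G t S Z) → Clean G t S F →
  ∀ (B : List (Subset (n G))) → Unique B → MinimalBlocking G t S F B →
  length B ≤ β


Pr : (G : Graph) (t : ℕ) (A B : Subset (n G)) → Family G
Pr G t A B Z =
  ∃[ K ] (IsTClique G t (A ∪ B) K × Nonempty (K ∩ A) × Nonempty (K ∩ B) × Z ≡ K ∩ B)

IsConf : (G : Graph) (t : ℕ) (S₁ S₂ : Subset (n G)) (c : ℤ) → Set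
IsConf G t S₁ S₂ c =
  ∃[ k₁ ] ∃[ k₂ ] (IsOpt G t S₂ (Pr G t S₁ S₂) k₁ × IsOpt G t S₂ (∅F G) k₂ × c ≡ + k₁ - + k₂)

module Submission where

-- Let k = opt(G[S₂]). By monotonicity of hitting sets, conf_A(S₂) = 0 iff some k-set hits
-- every t-clique of G[S₂] and every member of pr_A(S₂); since pr_A(S₂) grows with A, this
-- gives the forward direction. Conversely, if conf_{S₁}(S₂) > 0 then pr_{S₁}(S₂) is a
-- blocking set of the clean pair (G[S₂], ∅), so it contains an inclusion-wise minimal
-- blocking set B, and |B| ≤ β. Each member of B is K ∩ S₂ for a t-clique K meeting S₁ in at
-- most t - 1 vertices; the union S̄₁ of these sets K ∩ S₁ has at most (t - 1)β vertices and
-- B ⊆ pr_{S̄₁}(S₂), so conf_{S̄₁}(S₂) > 0.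

open import Defs
open import Level using (_⊔_)
open import Function using (_∘_)
open import Data.Nat using (ℕ; zero; suc; _≤_; _<_; _∸_; _*_; _+_; z≤n; s≤s; _≤?_)
import Data.Nat as ℕ
open import Data.Nat.Properties
  using (≤-trans; ≤-refl; ≤-reflexive; ≤-antisym; +-suc; +-identityʳ; +-mono-≤; m≤m+n;
         m+n≤o⇒m≤o∸n; *-suc; *-monoʳ-≤; ≰⇒>; ≮⇒≥; <⇒≱; module ≤-Reasoning)
open import Data.Nat.Induction using (<-wellFounded)
import Data.Integer as ℤ
open import Data.Integer.Properties using (+-injective; i-j≡0⇒i≡j; i≡j⇒i-j≡0)
open import Data.Bool using (true; false)
import Data.Bool as Bool
open import Data.Product using (∃-syntax; _×_; _,_; proj₁; proj₂)
import Data.Product as Prod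
open import Data.Sum using (inj₂; [_,_]′)
import Data.Sum as Sum
import Data.Fin as Fin
open import Data.Fin.Properties using (all?)
open import Data.Vec using ([]; _∷_)
open import Data.Vec.Properties using (≡-dec)
open import Data.Fin.Subset using (Subset; _⊆_; _∩_; _∪_; ∣_∣; Empty; Nonempty; _∈_; ⁅_⁆; ⊥)
open import Data.Fin.Subset.Properties
  using (anySubset?; nonempty?; _∈?_; _⊆?_; Empty-unique; ∣⊥∣≡0; ∣⁅x⁆∣≡1; x∈⁅y⁆⇒x≡y;
         p⊆q⇒∣p∣≤∣q∣; x∈p∩q⁺; x∈p∩q⁻; x∈p∪q⁻; p∩q⊆p; p∩q⊆q; p⊆p∪q; q⊆p∪q; ⊥⊆; ∩-comm)
open import Data.List using (List; []; _∷_; _++_; map; length; filter; deduplicate)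
open import Data.List.Properties using (++-identityʳ)
open import Data.List.Relation.Unary.Any using (here)
open import Data.List.Relation.Unary.All as All using (All; []; _∷_)
open import Data.List.Relation.Unary.Unique.Propositional using (Unique)
open import Data.List.Relation.Unary.Unique.DecPropositional.Properties using (deduplicate-!)
open import Data.List.Membership.Propositional using () renaming (_∈_ to _∈ᴸ_)
open import Data.List.Membership.Propositional.Properties
  using (∈-++⁺ˡ; ∈-++⁺ʳ; ∈-map⁺; ∈-filter⁺; ∈-filter⁻; ∈-deduplicate⁺; ∈-deduplicate⁻)
open import Data.List.Relation.Binary.Subset.Propositional using () renaming (_⊆_ to _⊆ᴸ_)
open import Data.List.Relation.Binary.Subset.Propositional.Properties
  using (xs⊆xs++ys; xs⊆x∷xs; ++⁺ʳ; ⊆∷∧∉⇒⊆; ⊆-reflexive-↭)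
  renaming (⊆-trans to ⊆ᴸ-trans; ⊆-reflexive to ⊆ᴸ-reflexive)
open import Data.List.Relation.Binary.Permutation.Propositional using (↭-sym)
open import Data.List.Relation.Binary.Permutation.Propositional.Properties using (shift)
open import Induction.WellFounded using (Acc; acc)
open import Relation.Nullary using (¬_; Dec; yes; no; ¬?; contradiction)
open import Relation.Nullary.Decidable using (_×-dec_; _⊎-dec_; _→-dec_; map′; decidable-stable)
open import Relation.Unary using (Pred; Decidable) renaming (_⊆_ to _⊆ᶠ_)
open import Relation.Binary.Definitions using (DecidableEquality)
open import Relation.Binary.PropositionalEquality using (_≡_; refl; cong; subst; module ≡-Reasoning)
import Relation.Binary.PropositionalEquality as ≡

∪-least : ∀ {m} {p q r : Subset m} → p ⊆ r → q ⊆ r → p ∪ q ⊆ r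
∪-least {p = p} {q} p⊆r q⊆r = [ p⊆r , q⊆r ]′ ∘ x∈p∪q⁻ p q

∣p∪q∣+∣p∩q∣≡∣p∣+∣q∣ : ∀ {m} (p q : Subset m) → ∣ p ∪ q ∣ + ∣ p ∩ q ∣ ≡ ∣ p ∣ + ∣ q ∣
∣p∪q∣+∣p∩q∣≡∣p∣+∣q∣ []          []          = refl
∣p∪q∣+∣p∩q∣≡∣p∣+∣q∣ (true ∷ p)  (true ∷ q)  = begin
  suc (∣ p ∪ q ∣ + suc ∣ p ∩ q ∣)  ≡⟨ cong suc (+-suc ∣ p ∪ q ∣ ∣ p ∩ q ∣) ⟩
  suc (suc (∣ p ∪ q ∣ + ∣ p ∩ q ∣)) ≡⟨ cong (suc ∘ suc) (∣p∪q∣+∣p∩q∣≡∣p∣+∣q∣ p q) ⟩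
  suc (suc (∣ p ∣ + ∣ q ∣))        ≡⟨ cong suc (≡.sym (+-suc ∣ p ∣ ∣ q ∣)) ⟩
  suc (∣ p ∣ + suc ∣ q ∣)          ∎
  where open ≡-Reasoning
∣p∪q∣+∣p∩q∣≡∣p∣+∣q∣ (true ∷ p)  (false ∷ q) = cong suc (∣p∪q∣+∣p∩q∣≡∣p∣+∣q∣ p q)
∣p∪q∣+∣p∩q∣≡∣p∣+∣q∣ (false ∷ p) (true ∷ q)  = begin
  suc (∣ p ∪ q ∣ + ∣ p ∩ q ∣) ≡⟨ cong suc (∣p∪q∣+∣p∩q∣≡∣p∣+∣q∣ p q) ⟩
  suc (∣ p ∣ + ∣ q ∣)         ≡⟨ ≡.sym (+-suc ∣ p ∣ ∣ q ∣) ⟩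
  ∣ p ∣ + suc ∣ q ∣           ∎
  where open ≡-Reasoning
∣p∪q∣+∣p∩q∣≡∣p∣+∣q∣ (false ∷ p) (false ∷ q) = ∣p∪q∣+∣p∩q∣≡∣p∣+∣q∣ p q

∣p∪q∣≤∣p∣+∣q∣ : ∀ {m} (p q : Subset m) → ∣ p ∪ q ∣ ≤ ∣ p ∣ + ∣ q ∣
∣p∪q∣≤∣p∣+∣q∣ p q = ≤-trans (m≤m+n ∣ p ∪ q ∣ ∣ p ∩ q ∣) (≤-reflexive (∣p∪q∣+∣p∩q∣≡∣p∣+∣q∣ p q))

Empty-∩⇒∣p∣+∣q∣≡∣p∪q∣ : ∀ {m} (p q : Subset m) → Empty (p ∩ q) → ∣ p ∣ + ∣ q ∣ ≡ ∣ p ∪ q ∣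
Empty-∩⇒∣p∣+∣q∣≡∣p∪q∣ {m} p q p∩q=∅ = begin
  ∣ p ∣ + ∣ q ∣              ≡⟨ ≡.sym (∣p∪q∣+∣p∩q∣≡∣p∣+∣q∣ p q) ⟩
  ∣ p ∪ q ∣ + ∣ p ∩ q ∣      ≡⟨ cong (λ r → ∣ p ∪ q ∣ + ∣ r ∣) (Empty-unique p∩q=∅) ⟩
  ∣ p ∪ q ∣ + ∣ ⊥ {m} ∣      ≡⟨ cong (∣ p ∪ q ∣ +_) (∣⊥∣≡0 m) ⟩
  ∣ p ∪ q ∣ + 0              ≡⟨ +-identityʳ ∣ p ∪ q ∣ ⟩
  ∣ p ∪ q ∣                  ∎
  where open ≡-Reasoning

Nonempty⇒1≤∣p∣ : ∀ {m} {p : Subset m} → Nonempty p → 1 ≤ ∣ p ∣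
Nonempty⇒1≤∣p∣ {p = p} (x , x∈p) = subst (_≤ ∣ p ∣) (∣⁅x⁆∣≡1 x) (p⊆q⇒∣p∣≤∣q∣ ⁅x⁆⊆p)
  where
  ⁅x⁆⊆p : ⁅ x ⁆ ⊆ p
  ⁅x⁆⊆p y∈⁅x⁆ = subst (_∈ p) (≡.sym (x∈⁅y⁆⇒x≡y x y∈⁅x⁆)) x∈p

1≤∣p∣⇒Nonempty : ∀ {m} {p : Subset m} → 1 ≤ ∣ p ∣ → Nonempty p
1≤∣p∣⇒Nonempty {m} {p} 1≤∣p∣ with nonempty? p
... | yes p≠∅ = p≠∅
... | no  p=∅ = contradiction (subst (λ r → 1 ≤ ∣ r ∣) (Empty-unique p=∅) 1≤∣p∣) 1≰∣⊥∣
  where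
  1≰∣⊥∣ : ¬ 1 ≤ ∣ ⊥ {m} ∣
  1≰∣⊥∣ 1≤∣⊥∣ = <⇒≱ 1≤∣⊥∣ (≤-reflexive (∣⊥∣≡0 m))

∣k∩a∣≤∣k∣∸1 : ∀ {m} (k a b : Subset m) → Empty (a ∩ b) → Nonempty (k ∩ b) → ∣ k ∩ a ∣ ≤ ∣ k ∣ ∸ 1
∣k∩a∣≤∣k∣∸1 k a b a∩b=∅ k∩b≠∅ = m+n≤o⇒m≤o∸n ∣ k ∩ a ∣ (begin
  ∣ k ∩ a ∣ + 1               ≤⟨ +-mono-≤ (≤-refl {∣ k ∩ a ∣}) (Nonempty⇒1≤∣p∣ k∩b≠∅) ⟩
  ∣ k ∩ a ∣ + ∣ k ∩ b ∣       ≡⟨ Empty-∩⇒∣p∣+∣q∣≡∣p∪q∣ (k ∩ a) (k ∩ b) parts-disjoint ⟩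
  ∣ (k ∩ a) ∪ (k ∩ b) ∣       ≤⟨ p⊆q⇒∣p∣≤∣q∣ parts⊆k ⟩
  ∣ k ∣                       ∎)
  where
  open ≤-Reasoning
  parts-disjoint : Empty ((k ∩ a) ∩ (k ∩ b))
  parts-disjoint (x , x∈) =
    let (x∈k∩a , x∈k∩b) = x∈p∩q⁻ (k ∩ a) (k ∩ b) x∈
    in a∩b=∅ (x , x∈p∩q⁺ (p∩q⊆q k a x∈k∩a , p∩q⊆q k b x∈k∩b))
  parts⊆k : (k ∩ a) ∪ (k ∩ b) ⊆ k
  parts⊆k = ∪-least (p∩q⊆p k a) (p∩q⊆p k b)

module _ {m ℓ} {P : Pred (Subset m) ℓ} (P? : Decidable P) where

  allSubsets? : Dec (∀ p → P p)
  allSubsets? with anySubset? (¬? ∘ P?)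
  ... | yes (p , ¬Pp) = no λ ∀P → ¬Pp (∀P p)
  ... | no  ∄¬P       = yes λ p → decidable-stable (P? p) (λ ¬Pp → ∄¬P (p , ¬Pp))

  least-∣∣ : ∀ {p} → P p → ∃[ q ] (P q × ∀ r → P r → ∣ q ∣ ≤ ∣ r ∣)
  least-∣∣ {p} = go p (<-wellFounded ∣ p ∣)
    where
    go : ∀ p → Acc _<_ ∣ p ∣ → P p → ∃[ q ] (P q × ∀ r → P r → ∣ q ∣ ≤ ∣ r ∣)
    go p (acc smaller) Pp with anySubset? (λ r → P? r ×-dec suc ∣ r ∣ ≤? ∣ p ∣)
    ... | yes (r , Pr , ∣r∣<∣p∣) = go r (smaller ∣r∣<∣p∣) Pr
    ... | no  ∄smaller           = p , Pp , λ r Pr → ≮⇒≥ λ ∣r∣<∣p∣ → ∄smaller (r , Pr , ∣r∣<∣p∣)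

subsets : ∀ m → List (Subset m)
subsets zero    = [] ∷ []
subsets (suc m) = map (true ∷_) (subsets m) ++ map (false ∷_) (subsets m)

∈-subsets : ∀ {m} (p : Subset m) → p ∈ᴸ subsets m
∈-subsets []          = here refl
∈-subsets (true ∷ p)  = ∈-++⁺ˡ (∈-map⁺ (true ∷_) (∈-subsets p))
∈-subsets (false ∷ p) = ∈-++⁺ʳ (map (true ∷_) (subsets _)) (∈-map⁺ (false ∷_) (∈-subsets p))

module _ {a ℓ} {A : Set a} (P : Pred (List A) ℓ) where

  Essential : List A → A → Set (a ⊔ ℓ)
  Essential ys z = ∀ xs → xs ⊆ᴸ ys → ¬ z ∈ᴸ xs → ¬ P xs

  Minimal : List A → Set (a ⊔ ℓ)
  Minimal xs = P xs × All (Essential xs) xs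

  Essential-antitone : ∀ {xs ys z} → xs ⊆ᴸ ys → Essential ys z → Essential xs z
  Essential-antitone xs⊆ys ess zs zs⊆xs = ess zs (⊆ᴸ-trans zs⊆xs xs⊆ys)

module _ {a ℓ} {A : Set a} {P : Pred (List A) ℓ} (P? : Decidable P)
         (P-mono : ∀ {xs ys} → xs ⊆ᴸ ys → P xs → P ys) where

  minimal-⊆ : ∀ {ys} → P ys → ∃[ xs ] (xs ⊆ᴸ ys × Minimal P xs)
  minimal-⊆ {ys} = prune [] ys []
    where
    -- Every kept element stays essential as the list shrinks, since Essential is antitone.
    prune : ∀ kept rest → All (Essential P (kept ++ rest)) kept → P (kept ++ rest) →
            ∃[ xs ] (xs ⊆ᴸ kept ++ rest × Minimal P xs)
    prune kept [] ess P-kept =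
      kept , xs⊆xs++ys kept [] ,
      P-mono (⊆ᴸ-reflexive (++-identityʳ kept)) P-kept ,
      All.map (Essential-antitone P (xs⊆xs++ys kept [])) ess
    prune kept (r ∷ rest) ess P-all with P? (kept ++ rest)
    ... | yes P-without-r =
      let (xs , xs⊆ , min) =
            prune kept rest (All.map (Essential-antitone P without-r⊆) ess) P-without-r
      in xs , ⊆ᴸ-trans xs⊆ without-r⊆ , min
      where
      without-r⊆ : kept ++ rest ⊆ᴸ kept ++ r ∷ rest
      without-r⊆ = ++⁺ʳ kept (xs⊆x∷xs rest r)
    ... | no ¬P-without-r =
      let (xs , xs⊆ , min) =
            prune (r ∷ kept) rest (r-essential ∷ All.map (Essential-antitone P from-front) ess)
                  (P-mono to-front P-all)
      in xs , ⊆ᴸ-trans xs⊆ from-front , min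
      where
      to-front : kept ++ r ∷ rest ⊆ᴸ r ∷ kept ++ rest
      to-front = ⊆-reflexive-↭ (shift r kept rest)
      from-front : r ∷ kept ++ rest ⊆ᴸ kept ++ r ∷ rest
      from-front = ⊆-reflexive-↭ (↭-sym (shift r kept rest))
      r-essential : Essential P (r ∷ kept ++ rest) r
      r-essential xs xs⊆ r∉xs Pxs = ¬P-without-r (P-mono (⊆∷∧∉⇒⊆ xs⊆ r∉xs) Pxs)

  minimal-unique-⊆ : DecidableEquality A → ∀ {ys} → P ys →
                     ∃[ xs ] (xs ⊆ᴸ ys × Unique xs × Minimal P xs)
  minimal-unique-⊆ _≟_ P-ys =
    let (xs , xs⊆ys , P-xs , ess) = minimal-⊆ P-ys
        dedup⊆xs = ∈-deduplicate⁻ _≟_ xs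
    in deduplicate _≟_ xs , ⊆ᴸ-trans dedup⊆xs xs⊆ys , deduplicate-! _≟_ xs ,
       P-mono (∈-deduplicate⁺ _≟_) P-xs ,
       All.tabulate (Essential-antitone P dedup⊆xs ∘ All.lookup ess ∘ dedup⊆xs)

_≟ˢ_ : ∀ {m} → DecidableEquality (Subset m)
_≟ˢ_ = ≡-dec Bool._≟_

module HittingSets (G : Graph) (t : ℕ) where

  IsClique? : Decidable (IsClique G)
  IsClique? K = map′ (λ adj {u} {v} → adj u v) (λ adj u v → adj)
    (all? λ u → all? λ v → u ∈? K →-dec v ∈? K →-dec ¬? (u Fin.≟ v) →-dec adj? G u v)

  IsTClique? : ∀ S → Decidable (IsTClique G t S)
  IsTClique? S K = K ⊆? S ×-dec ∣ K ∣ ℕ.≟ t ×-dec IsClique? K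

  Hits? : ∀ S {F} → Decidable F → Decidable (Hits G t S F)
  Hits? S F? X = X ⊆? S
    ×-dec allSubsets? (λ K → IsTClique? S K →-dec nonempty? (K ∩ X))
    ×-dec allSubsets? (λ Z → F? Z →-dec nonempty? (Z ∩ X))

  Pr? : ∀ A B → Decidable (Pr G t A B)
  Pr? A B Z = anySubset? λ K →
    IsTClique? (A ∪ B) K ×-dec nonempty? (K ∩ A) ×-dec nonempty? (K ∩ B) ×-dec Z ≟ˢ (K ∩ B)

  HitsWithin : Subset (n G) → Family G → ℕ → Set
  HitsWithin S F k = ∃[ X ] (Hits G t S F X × ∣ X ∣ ≤ k)

  HitsWithin? : ∀ S {F} → Decidable F → ∀ k → Dec (HitsWithin S F k)
  HitsWithin? S F? k = anySubset? λ X → Hits? S F? X ×-dec ∣ X ∣ ≤? k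

  HitsWithin-mono : ∀ {S F k k′} → k ≤ k′ → HitsWithin S F k → HitsWithin S F k′
  HitsWithin-mono k≤k′ (X , hits-X , ∣X∣≤k) = X , hits-X , ≤-trans ∣X∣≤k k≤k′

  Hits-antitone : ∀ {S F F′ X} → F ⊆ᶠ F′ → Hits G t S F′ X → Hits G t S F X
  Hits-antitone F⊆F′ (X⊆S , hits-cliques , hits-F′) = X⊆S , hits-cliques , λ Z → hits-F′ Z ∘ F⊆F′

  HitsWithin-antitone : ∀ {S F F′ k} → F ⊆ᶠ F′ → HitsWithin S F′ k → HitsWithin S F k
  HitsWithin-antitone F⊆F′ (X , hits , ∣X∣≤k) = X , Hits-antitone F⊆F′ hits , ∣X∣≤k

  Hits-whole : ∀ {S F} → 1 ≤ t → F ⊆ᶠ Admissible G t S → Hits G t S F S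
  Hits-whole {S} {F} 1≤t F-admissible = (λ x∈S → x∈S) , hits-clique , hits-F
    where
    nonempty-within : ∀ {Z} → Z ⊆ S → 1 ≤ ∣ Z ∣ → Nonempty (Z ∩ S)
    nonempty-within Z⊆S 1≤∣Z∣ =
      let (x , x∈Z) = 1≤∣p∣⇒Nonempty 1≤∣Z∣ in x , x∈p∩q⁺ (x∈Z , Z⊆S x∈Z)
    hits-clique : ∀ K → IsTClique G t S K → Nonempty (K ∩ S)
    hits-clique K (K⊆S , ∣K∣≡t , _) = nonempty-within K⊆S (subst (1 ≤_) (≡.sym ∣K∣≡t) 1≤t)
    hits-F : ∀ Z → F Z → Nonempty (Z ∩ S)
    hits-F Z FZ = let (Z⊆S , 1≤∣Z∣ , _) = F-admissible FZ in nonempty-within Z⊆S 1≤∣Z∣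

  IsOpt-unique : ∀ {S F k k′} → IsOpt G t S F k → IsOpt G t S F k′ → k ≡ k′
  IsOpt-unique ((X , hits-X , refl) , least) ((Y , hits-Y , refl) , least′) =
    ≤-antisym (least Y hits-Y) (least′ X hits-X)

  IsOpt-exists : ∀ {S F} → 1 ≤ t → Decidable F → F ⊆ᶠ Admissible G t S → ∃[ k ] IsOpt G t S F k
  IsOpt-exists 1≤t F? F-admissible =
    let (X , hits-X , least) = least-∣∣ (Hits? _ F?) (Hits-whole 1≤t F-admissible)
    in ∣ X ∣ , (X , hits-X , refl) , least

  IsOpt⇒HitsWithin : ∀ {S F k} → IsOpt G t S F k → HitsWithin S F k
  IsOpt⇒HitsWithin ((X , hits-X , ∣X∣≡k) , _) = X , hits-X , ≤-reflexive ∣X∣≡k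

  HitsWithin⇒IsOpt : ∀ {S F k} → IsOpt G t S (∅F G) k → HitsWithin S F k → IsOpt G t S F k
  HitsWithin⇒IsOpt (_ , least-∅) (X , hits-X , ∣X∣≤k) =
    (X , hits-X , ≤-antisym ∣X∣≤k (least-∅ X (Hits-antitone (λ ()) hits-X))) ,
    λ Y hits-Y → least-∅ Y (Hits-antitone (λ ()) hits-Y)

  ∅? : Decidable (∅F G)
  ∅? _ = no λ ()

  _∪ᴸ_ : Family G → List (Subset (n G)) → Family G
  F ∪ᴸ B = _∪F_ {G} F (listF {G} B)

  _∪ᴸ?_ : ∀ {F} → Decidable F → ∀ B → Decidable (F ∪ᴸ B)
  (F? ∪ᴸ? B) Z = F? Z ⊎-dec Z ∈ᴸ? B
    where open import Data.List.Membership.DecPropositional _≟ˢ_ using () renaming (_∈?_ to _∈ᴸ?_)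

  Raises : Subset (n G) → Family G → ℕ → List (Subset (n G)) → Set
  Raises S F k B = ¬ HitsWithin S (F ∪ᴸ B) k

  Raises? : ∀ S {F} → Decidable F → ∀ k → Decidable (Raises S F k)
  Raises? S F? k B = ¬? (HitsWithin? S (F? ∪ᴸ? B) k)

  Raises-mono : ∀ {S F k B C} → B ⊆ᴸ C → Raises S F k B → Raises S F k C
  Raises-mono B⊆C ¬within-B within-C = ¬within-B (HitsWithin-antitone (Sum.map₂ B⊆C) within-C)

  Blocking⇒Raises : ∀ {S F k B} → IsOpt G t S F k → Blocking G t S F B → Raises S F k B
  Blocking⇒Raises opt (_ , k₀ , k′ , opt′ , opt₀ , k₀<k′) (X , hits-X , ∣X∣≤k)
    with IsOpt-unique opt₀ opt
  ... | refl = <⇒≱ k₀<k′ (≤-trans (proj₂ opt′ X hits-X) ∣X∣≤k)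

  Raises⇒Blocking : ∀ {S F k B} → 1 ≤ t → Decidable F → F ⊆ᶠ Admissible G t S →
                    IsOpt G t S F k → All (Admissible G t S) B → Raises S F k B → Blocking G t S F B
  Raises⇒Blocking {B = B} 1≤t F? F-admissible opt B-admissible raises =
    let (k′ , opt′) = IsOpt-exists 1≤t (F? ∪ᴸ? B) [ F-admissible , All.lookup B-admissible ]′
    in (λ _ → All.lookup B-admissible) , _ , k′ , opt′ , opt ,
       ≰⇒> λ k′≤k → raises (HitsWithin-mono k′≤k (IsOpt⇒HitsWithin opt′))

  Minimal-Raises⇒MinimalBlocking :
    ∀ {S F k B} → 1 ≤ t → Decidable F → F ⊆ᶠ Admissible G t S → IsOpt G t S F k →
    All (Admissible G t S) B → Minimal (Raises S F k) B → MinimalBlocking G t S F B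
  Minimal-Raises⇒MinimalBlocking 1≤t F? F-admissible opt B-admissible (raises , essential) =
    Raises⇒Blocking 1≤t F? F-admissible opt B-admissible raises ,
    λ B′ B′⊆B (Z , Z∈B , Z∉B′) blocking′ →
      All.lookup essential Z∈B B′ (B′⊆B _) Z∉B′ (Blocking⇒Raises opt blocking′)

  Pr-mono : ∀ {A A′ B} → A ⊆ A′ → Pr G t A B ⊆ᶠ Pr G t A′ B
  Pr-mono {A} {A′} {B} A⊆A′ (K , (K⊆A∪B , ∣K∣≡t , K-clique) , (x , x∈K∩A) , K∩B≠∅ , Z≡K∩B) =
    K , (A∪B⊆A′∪B ∘ K⊆A∪B , ∣K∣≡t , K-clique) ,
    (x , x∈p∩q⁺ (Prod.map₂ A⊆A′ (x∈p∩q⁻ K A x∈K∩A))) , K∩B≠∅ , Z≡K∩B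
    where
    A∪B⊆A′∪B : A ∪ B ⊆ A′ ∪ B
    A∪B⊆A′∪B = ∪-least (p⊆p∪q B ∘ A⊆A′) (q⊆p∪q A′ B)

  Pr-trace : ∀ {A B Z} (pr : Pr G t A B Z) → Pr G t (proj₁ pr ∩ A) B Z
  Pr-trace {A} {B} (K , (K⊆A∪B , ∣K∣≡t , K-clique) , (x , x∈K∩A) , K∩B≠∅ , Z≡K∩B) =
    K , (K⊆K∩A∪B , ∣K∣≡t , K-clique) ,
    (x , x∈p∩q⁺ (p∩q⊆p K A x∈K∩A , x∈K∩A)) , K∩B≠∅ , Z≡K∩B
    where
    K⊆K∩A∪B : K ⊆ (K ∩ A) ∪ B
    K⊆K∩A∪B y∈K = [ (λ y∈A → p⊆p∪q B (x∈p∩q⁺ (y∈K , y∈A))) , q⊆p∪q (K ∩ A) B ]′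
                  (x∈p∪q⁻ A B (K⊆A∪B y∈K))

  ∣Pr-trace∣≤t∸1 : ∀ {A B Z} → Empty (A ∩ B) → (pr : Pr G t A B Z) → ∣ proj₁ pr ∩ A ∣ ≤ t ∸ 1
  ∣Pr-trace∣≤t∸1 {A} {B} A∩B=∅ (K , (_ , refl , _) , _ , K∩B≠∅ , _) = ∣k∩a∣≤∣k∣∸1 K A B A∩B=∅ K∩B≠∅

  Pr⇒Admissible : ∀ {A B} → Empty (A ∩ B) → Pr G t A B ⊆ᶠ Admissible G t B
  Pr⇒Admissible {A} {B} A∩B=∅ (K , (_ , refl , K-clique) , K∩A≠∅ , K∩B≠∅ , refl) =
    p∩q⊆q K B , Nonempty⇒1≤∣p∣ K∩B≠∅ , ∣k∩a∣≤∣k∣∸1 K B A B∩A=∅ K∩A≠∅ ,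
    λ u∈ v∈ → K-clique (p∩q⊆p K B u∈) (p∩q⊆p K B v∈)
    where
    B∩A=∅ : Empty (B ∩ A)
    B∩A=∅ = subst Empty (∩-comm A B) A∩B=∅

  Pr-small-support : ∀ {A B Zs} → Empty (A ∩ B) → All (Pr G t A B) Zs →
    ∃[ A′ ] (A′ ⊆ A × ∣ A′ ∣ ≤ (t ∸ 1) * length Zs × All (Pr G t A′ B) Zs)
  Pr-small-support A∩B=∅ [] = ⊥ , ⊥⊆ , ≤-trans (≤-reflexive (∣⊥∣≡0 (n G))) z≤n , []
  Pr-small-support {A} {B} {_ ∷ Zs} A∩B=∅ (pr ∷ prs) =
    let (A′ , A′⊆A , ∣A′∣≤ , prs′) = Pr-small-support A∩B=∅ prs
        trace = proj₁ pr ∩ A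
    in trace ∪ A′ , ∪-least (p∩q⊆q (proj₁ pr) A) A′⊆A ,
       (begin
         ∣ trace ∪ A′ ∣                    ≤⟨ ∣p∪q∣≤∣p∣+∣q∣ trace A′ ⟩
         ∣ trace ∣ + ∣ A′ ∣                 ≤⟨ +-mono-≤ (∣Pr-trace∣≤t∸1 A∩B=∅ pr) ∣A′∣≤ ⟩
         (t ∸ 1) + (t ∸ 1) * length Zs    ≡⟨ *-suc (t ∸ 1) (length Zs) ⟨
         (t ∸ 1) * suc (length Zs)        ∎) ,
       Pr-mono (p⊆p∪q A′) (Pr-trace pr) ∷ All.map (Pr-mono (q⊆p∪q trace A′)) prs′
    where open ≤-Reasoning

  module _ {S₁ S₂ : Subset (n G)} {β k : ℕ} (1≤t : 1 ≤ t) (S₁∩S₂=∅ : Empty (S₁ ∩ S₂))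
           (mmbs : MmbsAtMost G t S₂ β) (opt : IsOpt G t S₂ (∅F G) k)
           (local : ∀ S̄₁ → S̄₁ ⊆ S₁ → ∣ S̄₁ ∣ ≤ (t ∸ 1) * β → HitsWithin S₂ (Pr G t S̄₁ S₂) k) where

    ¬Raises-Pr : ∀ {Zs} → All (Pr G t S₁ S₂) Zs → ¬ Raises S₂ (∅F G) k Zs
    ¬Raises-Pr prs raises =
      let (B , B⊆Zs , B-unique , minimal) =
            minimal-unique-⊆ (Raises? S₂ ∅? k) Raises-mono _≟ˢ_ raises
          prB = All.tabulate (All.lookup prs ∘ B⊆Zs)
          B-admissible = All.map (Pr⇒Admissible S₁∩S₂=∅) prB
          ∣B∣≤β = mmbs (∅F G) (λ _ ()) (k , opt , opt) B B-unique
                    (Minimal-Raises⇒MinimalBlocking 1≤t ∅? (λ ()) opt B-admissible minimal)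
          (S̄₁ , S̄₁⊆S₁ , ∣S̄₁∣≤ , prB′) = Pr-small-support S₁∩S₂=∅ prB
      in proj₁ minimal (HitsWithin-antitone [ (λ ()) , All.lookup prB′ ]′
           (local S̄₁ S̄₁⊆S₁ (≤-trans ∣S̄₁∣≤ (*-monoʳ-≤ (t ∸ 1) ∣B∣≤β))))

    HitsWithin-Pr-from-local : HitsWithin S₂ (Pr G t S₁ S₂) k
    HitsWithin-Pr-from-local =
      HitsWithin-antitone (inj₂ ∘ ∈-all-Pr)
        (decidable-stable (HitsWithin? S₂ (∅? ∪ᴸ? all-Pr) k) (¬Raises-Pr all-Pr-are-Pr))
      where
      all-Pr : List (Subset (n G))
      all-Pr = filter (Pr? S₁ S₂) (subsets (n G))
      ∈-all-Pr : ∀ {Z} → Pr G t S₁ S₂ Z → Z ∈ᴸ all-Pr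
      ∈-all-Pr {Z} = ∈-filter⁺ (Pr? S₁ S₂) (∈-subsets Z)
      all-Pr-are-Pr : All (Pr G t S₁ S₂) all-Pr
      all-Pr-are-Pr = All.tabulate (proj₂ ∘ ∈-filter⁻ (Pr? S₁ S₂) {xs = subsets (n G)})

  IsConf-zero⇒HitsWithin : ∀ {A S k} → IsOpt G t S (∅F G) k →
                           IsConf G t A S (ℤ.+ 0) → HitsWithin S (Pr G t A S) k
  IsConf-zero⇒HitsWithin opt (k₁ , k₂ , opt₁ , opt₂ , 0≡k₁-k₂)
    with +-injective (i-j≡0⇒i≡j (ℤ.+ k₁) (ℤ.+ k₂) (≡.sym 0≡k₁-k₂)) | IsOpt-unique opt₂ opt
  ... | refl | refl = IsOpt⇒HitsWithin opt₁

  HitsWithin⇒IsConf-zero : ∀ {A S k} → IsOpt G t S (∅F G) k →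
                           HitsWithin S (Pr G t A S) k → IsConf G t A S (ℤ.+ 0)
  HitsWithin⇒IsConf-zero {k = k} opt within =
    k , k , HitsWithin⇒IsOpt opt within , opt , ≡.sym (i≡j⇒i-j≡0 {i = ℤ.+ k} refl)

-- Opened only here: the prefix +_ makes sums of cardinalities above ambiguous.
open import Data.Integer using (+_)

lemma35 : (G : Graph) (t : ℕ) → 3 ≤ t →
    (S₁ S₂ : Subset (n G)) → Empty (S₁ ∩ S₂) → NoTClique G t S₁ →
    (β : ℕ) → MmbsAtMost G t S₂ β →
    (IsConf G t S₁ S₂ (+ 0) →
       (∀ S̄₁ → S̄₁ ⊆ S₁ → ∣ S̄₁ ∣ ≤ (t ∸ 1) * β → IsConf G t S̄₁ S₂ (+ 0))) ×
    ((∀ S̄₁ → S̄₁ ⊆ S₁ → ∣ S̄₁ ∣ ≤ (t ∸ 1) * β → IsConf G t S̄₁ S₂ (+ 0)) →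
       IsConf G t S₁ S₂ (+ 0))
lemma35 G t 3≤t S₁ S₂ S₁∩S₂=∅ _ β mmbs = forward , backward
  where
  open HittingSets G t
  1≤t : 1 ≤ t
  1≤t = ≤-trans (s≤s z≤n) 3≤t
  opt-S₂ : ∃[ k ] IsOpt G t S₂ (∅F G) k
  opt-S₂ = IsOpt-exists 1≤t ∅? (λ ())
  k : ℕ
  k = proj₁ opt-S₂
  opt : IsOpt G t S₂ (∅F G) k
  opt = proj₂ opt-S₂
  ZeroOnSmall : Subset (n G) → Set
  ZeroOnSmall A = ∀ S̄₁ → S̄₁ ⊆ A → ∣ S̄₁ ∣ ≤ (t ∸ 1) * β → IsConf G t S̄₁ S₂ (+ 0)
  forward : IsConf G t S₁ S₂ (+ 0) → ZeroOnSmall S₁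
  forward conf S̄₁ S̄₁⊆S₁ _ =
    HitsWithin⇒IsConf-zero opt
      (HitsWithin-antitone (Pr-mono S̄₁⊆S₁) (IsConf-zero⇒HitsWithin opt conf))
  backward : ZeroOnSmall S₁ → IsConf G t S₁ S₂ (+ 0)
  backward local = HitsWithin⇒IsConf-zero opt (HitsWithin-Pr-from-local 1≤t S₁∩S₂=∅ mmbs opt
    λ S̄₁ S̄₁⊆S₁ ∣S̄₁∣≤ → IsConf-zero⇒HitsWithin opt (local S̄₁ S̄₁⊆S₁ ∣S̄₁∣≤))
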